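{- Let $H(X,Y,E)$ be a complete bipartite $r$-uniform hypergraph with $|X|=|Y|=r$, and let $\delta$ be the degree of each vertex of $H$. Then $ed_t(H)=\delta$.
   Context: A hypergraph has a finite vertex set and a set of hyperedges, each a subset of the vertex set; it is $r$-uniform if every hyperedge has exactly $r$ vertices. A complete bipartite $r$-uniform hypergraph $H(X,Y,E)$ ($r\ge 2$) has vertex set $X\cup Y$ with $X,Y$ disjoint and nonempty, and its hyperedges are all $r$-element subsets of $X\cup Y$ containing at least one vertex of $X$ and at least one vertex of $Y$. The degree of a vertex is the number of hyperedges containing it. Two distinct hyperedges are adjacent if they share at least one vertex; a hyperedge is not adjacent to itself. A total edge-dominating set is a subset $E_t\subseteq E$ such that every hyperedge in $E$ is adjacent to some hyperedge in $E_t$. The total edge-domatic number $ed_t(H)$ is the maximum number of classes in a partition of $E$ into total edge-dominating sets. -}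

module Defs where

open import Data.Nat using (ℕ; _≤_; _+_)
open import Data.Nat.Properties using (_≟_)
open import Data.Fin using (Fin; _↑ˡ_; _↑ʳ_)
open import Data.Fin.Properties using (any?)
open import Data.Fin.Subset using (Subset; _∈_; ∣_∣)
open import Data.Fin.Subset.Properties using (_∈?_)
open import Data.Product using (Σ; ∃; _×_; proj₁)
open import Relation.Nullary using (Dec; ¬_)
open import Relation.Nullary.Decidable using (True; _×-dec_)
open import Relation.Binary.PropositionalEquality using (_≡_)
open import Function.Bundles using (_↔_)

-- The complete bipartite r-uniform hypergraph with |X| = |Y| = r.
-- Vertex set: Fin (r + r); X = { i ↑ˡ r | i : Fin r } (first r vertices),
-- Y = { r ↑ʳ j | j : Fin r } (last r vertices).
Vertex : ℕ → Set
Vertex r = Fin (r + r)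

IsEdgeP : (r : ℕ) → Subset (r + r) → Set
IsEdgeP r s = (∣ s ∣ ≡ r)
            × (∃ λ (i : Fin r) → (i ↑ˡ r) ∈ s)
            × (∃ λ (j : Fin r) → (r ↑ʳ j) ∈ s)

isEdge? : (r : ℕ) → (s : Subset (r + r)) → Dec (IsEdgeP r s)
isEdge? r s = (∣ s ∣ ≟ r)
         ×-dec (any? (λ i → (i ↑ˡ r) ∈? s))
         ×-dec (any? (λ j → (r ↑ʳ j) ∈? s))

-- Hyperedges: subsets together with a (proof-irrelevant) certificate of
-- being a hyperedge, so that distinct hyperedges are distinct subsets.
Edge : ℕ → Set
Edge r = Σ (Subset (r + r)) (λ s → True (isEdge? r s))

HasDegree : (r : ℕ) → Vertex r → ℕ → Set
HasDegree r v d = Fin d ↔ Σ (Edge r) (λ e → v ∈ proj₁ e)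

Adjacent : (r : ℕ) → Edge r → Edge r → Set
Adjacent r e f = ¬ (proj₁ e ≡ proj₁ f)
               × (∃ λ (v : Vertex r) → v ∈ proj₁ e × v ∈ proj₁ f)

TotalEdgeDomaticPartition : (r k : ℕ) → Set
TotalEdgeDomaticPartition r k =
  Σ (Edge r → Fin k) λ c →
    ∀ (i : Fin k) (e : Edge r) → ∃ λ (f : Edge r) → c f ≡ i × Adjacent r e f

TotalEdgeDomaticNumberIs : (r d : ℕ) → Set
TotalEdgeDomaticNumberIs r d =
  TotalEdgeDomaticPartition r d × (∀ k → TotalEdgeDomaticPartition r k → k ≤ d)

-- Fix a vertex v.  Since |X| = |Y| = r, the complement of a hyperedge is again
-- a hyperedge, and exactly one of e, ∁ e contains v; so the hyperedges split
-- into δ complementary pairs, indexed by the hyperedges through v.  Two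
-- hyperedges of size r in a vertex set of size 2r are disjoint only if they are
-- complementary, so hyperedges from different pairs are adjacent.  Every class
-- of a total edge-dominating partition contains two adjacent, hence distinct,
-- hyperedges, so the 2δ hyperedges admit at most δ classes.  Conversely, put the
-- member of pair i through v into class i and the other member into class
-- i - 1 (mod δ): each class then meets two different pairs, hence dominates
-- every hyperedge (δ ≥ 2 because r ≥ 2 leaves room for two hyperedges through v).
module Submission where

open import Defs
open import Data.Nat using (ℕ; zero; suc; _+_; _∸_; _≤_; _<_; z≤n; s≤s)
open import Data.Nat.Properties
  using (≤-reflexive; <⇒≢; <⇒≱; ≮⇒≥; +-mono-<; m<m+n; m<n+m; m+n∸n≡m; 1+n≢n)
open import Data.Bool using (true; false; not)
open import Data.Bool.Properties using (T-irrelevant)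
open import Data.Fin using (Fin; zero; suc; toℕ; fromℕ; inject₁; _↑ˡ_; _↑ʳ_; _≟_)
open import Data.Fin.Properties using (+↔⊎; injective⇒≤; toℕ-inject₁)
open import Data.Fin.Relation.Unary.Top using (view; ‵fromℕ; ‵inject₁)
open import Data.Fin.Subset
  using (Subset; _∈_; _∉_; _⊆_; _∩_; ∁; ⊤; ⊥; ⁅_⁆; ∣_∣; Nonempty)
open import Data.Fin.Subset.Properties
  using ( _∈?_; nonempty?; ⊆⊤; ⊥⊆; ∉⊥; ⊆-antisym; ∣⊤∣≡n; ∣⊥∣≡0; ∣⁅x⁆∣≡1
        ; p⊂q⇒∣p∣<∣q∣; x∈p⇒x∉∁p; x∉∁p⇒x∈p; x∉p⇒x∈∁p; ∣∁p∣≡n∸∣p∣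
        ; x∈p∩q⁺; x∈p∩q⁻; ∪-∩-booleanAlgebra; x≢y⇒x∉⁅y⁆ )
open import Data.Vec using ([]; _∷_; _++_; splitAt; here)
open import Data.Vec.Properties
  using (lookup-++ˡ; lookup-++ʳ; []=⇒lookup; lookup⇒[]=; map-++; ∷-injectiveˡ; ++-injectiveʳ)
open import Data.Vec.Properties.WithK using ([]=-irrelevant)
open import Data.Product using (Σ; ∃; _×_; _,_; proj₁; proj₂)
open import Data.Sum using (_⊎_; inj₁; inj₂; [_,_]′; map; swap; reduce)
open import Data.Sum.Function.Propositional using (_⊎-↔_)
open import Function using (id; _∘_)
open import Function.Bundles
  using (_↔_; _↣_; _⇔_; Inverse; Injection; Equivalence; mk↣; mk⇔; mk↔ₛ′)
open import Function.Construct.Composition using (_↣-∘_)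
open import Function.Definitions using (Injective)
open import Function.Properties.Inverse using (↔-sym; ↔-trans; ↔⇒↣)
open import Algebra.Lattice.Properties.BooleanAlgebra as BooleanAlgebraProperties using ()
open import Relation.Binary.Definitions using (Irreflexive)
open import Relation.Nullary using (yes; no; contradiction)
open import Relation.Nullary.Decidable using (fromWitness; toWitness; decidable-stable)
open import Relation.Binary.PropositionalEquality

private
  variable
    m n : ℕ

rotate : Fin (suc n) → Fin (suc n)
rotate zero    = fromℕ _
rotate (suc i) = inject₁ i

rotate-preimage : (i : Fin (2 + n)) → ∃ λ j → rotate j ≡ i × j ≢ i
rotate-preimage i with view i
... | ‵fromℕ     = zero , refl , λ ()
... | ‵inject₁ k = suc k , refl , λ eq → 1+n≢n (trans (cong toℕ eq) (toℕ-inject₁ k))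

module TotalDomination {A : Set} (_~_ : A → A → Set) where

  TotalDomaticPartition : ℕ → Set
  TotalDomaticPartition k =
    Σ (A → Fin k) λ c → ∀ (i : Fin k) (a : A) → ∃ λ (b : A) → c b ≡ i × a ~ b

  TotalDomaticNumberIs : ℕ → Set
  TotalDomaticNumberIs d =
    TotalDomaticPartition d × (∀ k → TotalDomaticPartition k → k ≤ d)

  partition-doubled : Irreflexive _≡_ _~_ → A → ∀ {k} →
                      TotalDomaticPartition k → (Fin k ⊎ Fin k) ↣ A
  partition-doubled ~-irrefl a₀ {k} (c , dominates) = mk↣ pair-injective
    where
    first second : Fin k → A
    first i  = proj₁ (dominates i a₀)
    second i = proj₁ (dominates i (first i))

    pair : Fin k ⊎ Fin k → A
    pair = [ first , second ]′

    class-pair : ∀ x → c (pair x) ≡ reduce x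
    class-pair (inj₁ i) = proj₁ (proj₂ (dominates i a₀))
    class-pair (inj₂ i) = proj₁ (proj₂ (dominates i (first i)))

    same-class : ∀ {x y} → pair x ≡ pair y → reduce x ≡ reduce y
    same-class {x} {y} eq = trans (sym (class-pair x)) (trans (cong c eq) (class-pair y))

    first≢second : ∀ i → first i ≢ second i
    first≢second i eq = ~-irrefl eq (proj₂ (proj₂ (dominates i (first i))))

    pair-injective : Injective _≡_ _≡_ pair
    pair-injective {inj₁ i} {inj₁ j} eq = cong inj₁ (same-class {inj₁ i} {inj₁ j} eq)
    pair-injective {inj₂ i} {inj₂ j} eq = cong inj₂ (same-class {inj₂ i} {inj₂ j} eq)
    pair-injective {inj₁ i} {inj₂ j} eq with same-class {inj₁ i} {inj₂ j} eq
    ... | refl = contradiction eq (first≢second i)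
    pair-injective {inj₂ i} {inj₁ j} eq with same-class {inj₂ i} {inj₁ j} eq
    ... | refl = contradiction (sym eq) (first≢second i)

  module _ {δ : ℕ} (code : A ↔ (Fin δ ⊎ Fin δ)) where
    open Inverse code

    label : A → Fin δ
    label = reduce ∘ to

    partition-from-pairs : (∀ {a b} → label a ≢ label b → a ~ b) → 2 ≤ δ →
                           TotalDomaticPartition δ
    partition-from-pairs distinct⇒~ (s≤s (s≤s z≤n)) = class , dominates
      where
      class : A → Fin δ
      class = [ id , rotate ]′ ∘ to

      label-from : ∀ x → label (from x) ≡ reduce x
      label-from x = cong reduce (strictlyInverseˡ x)

      dominates : ∀ i a → ∃ λ b → class b ≡ i × a ~ b
      dominates i a with label a ≟ i
      ... | no  ℓ≢i = from (inj₁ i) , cong [ id , rotate ]′ (strictlyInverseˡ (inj₁ i)) ,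
                      distinct⇒~ (λ eq → ℓ≢i (trans eq (label-from (inj₁ i))))
      ... | yes ℓ≡i with rotate-preimage i
      ...   | j , rotate-j≡i , j≢i =
        from (inj₂ j) , trans (cong [ id , rotate ]′ (strictlyInverseˡ (inj₂ j))) rotate-j≡i ,
        distinct⇒~ (λ eq → j≢i (trans (sym (label-from (inj₂ j))) (trans (sym eq) ℓ≡i)))

    partition-≤ : Irreflexive _≡_ _~_ → A → ∀ {k} → TotalDomaticPartition k → k ≤ δ
    partition-≤ ~-irrefl a₀ {k} P = halve (injective⇒≤ (Injection.injective fin-injection))
      where
      fin-injection : Fin (k + k) ↣ Fin (δ + δ)
      fin-injection =
        ↔⇒↣ (↔-sym +↔⊎) ↣-∘ (↔⇒↣ code ↣-∘ (partition-doubled ~-irrefl a₀ P ↣-∘ ↔⇒↣ +↔⊎))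

      halve : k + k ≤ δ + δ → k ≤ δ
      halve k+k≤δ+δ = ≮⇒≥ (λ δ<k → <⇒≱ (+-mono-< δ<k δ<k) k+k≤δ+δ)

    totalDomaticNumber-pairs : Irreflexive _≡_ _~_ → (∀ {a b} → label a ≢ label b → a ~ b) →
                               2 ≤ δ → TotalDomaticNumberIs δ
    totalDomaticNumber-pairs ~-irrefl distinct⇒~ 2≤δ@(s≤s (s≤s z≤n)) =
      partition-from-pairs distinct⇒~ 2≤δ , λ k → partition-≤ ~-irrefl (from (inj₁ zero))

∁-involutive : (p : Subset n) → ∁ (∁ p) ≡ p
∁-involutive {n} = ¬-involutive
  where open BooleanAlgebraProperties (∪-∩-booleanAlgebra n)

∁-++ : (p : Subset m) (q : Subset n) → ∁ (p ++ q) ≡ ∁ p ++ ∁ q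
∁-++ = map-++ not

∣p++q∣≡∣p∣+∣q∣ : (p : Subset m) (q : Subset n) → ∣ p ++ q ∣ ≡ ∣ p ∣ + ∣ q ∣
∣p++q∣≡∣p∣+∣q∣ []          q = refl
∣p++q∣≡∣p∣+∣q∣ (true ∷ p)  q = cong suc (∣p++q∣≡∣p∣+∣q∣ p q)
∣p++q∣≡∣p∣+∣q∣ (false ∷ p) q = ∣p++q∣≡∣p∣+∣q∣ p q

↑ˡ∈++⇔∈ : (p : Subset m) (q : Subset n) {i : Fin m} → i ↑ˡ n ∈ p ++ q ⇔ i ∈ p
↑ˡ∈++⇔∈ p q {i} = mk⇔
  (λ h → lookup⇒[]= i p (trans (sym (lookup-++ˡ p q i)) ([]=⇒lookup h)))
  (λ h → lookup⇒[]= (i ↑ˡ _) (p ++ q) (trans (lookup-++ˡ p q i) ([]=⇒lookup h)))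

↑ʳ∈++⇔∈ : (p : Subset m) (q : Subset n) {j : Fin n} → m ↑ʳ j ∈ p ++ q ⇔ j ∈ q
↑ʳ∈++⇔∈ {m} p q {j} = mk⇔
  (λ h → lookup⇒[]= j q (trans (sym (lookup-++ʳ p q j)) ([]=⇒lookup h)))
  (λ h → lookup⇒[]= (m ↑ʳ j) (p ++ q) (trans (lookup-++ʳ p q j) ([]=⇒lookup h)))

Nonempty⇒∣p∣>0 : {p : Subset n} → Nonempty p → 0 < ∣ p ∣
Nonempty⇒∣p∣>0 {n} {p} (x , x∈p) =
  subst (_< ∣ p ∣) (∣⊥∣≡0 n) (p⊂q⇒∣p∣<∣q∣ {p = ⊥} (⊥⊆ , x , x∈p , ∉⊥))

∣p∣<n⇒Nonempty∁p : {p : Subset n} → ∣ p ∣ < n → Nonempty (∁ p)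
∣p∣<n⇒Nonempty∁p {p = p} ∣p∣<n with nonempty? (∁ p)
... | yes ∁p-nonempty = ∁p-nonempty
... | no  ∁p-empty    = contradiction (trans (cong ∣_∣ p≡⊤) (∣⊤∣≡n _)) (<⇒≢ ∣p∣<n)
  where
  p≡⊤ : p ≡ ⊤
  p≡⊤ = ⊆-antisym ⊆⊤ (λ {x} _ → x∉∁p⇒x∈p (λ x∈∁p → ∁p-empty (x , x∈∁p)))

∣p∣≡n⇒∣∁p∣≡m : (p : Subset (m + n)) → ∣ p ∣ ≡ n → ∣ ∁ p ∣ ≡ m
∣p∣≡n⇒∣∁p∣≡m {m} {n} p ∣p∣≡n = trans (∣∁p∣≡n∸∣p∣ p) (trans (cong (m + n ∸_) ∣p∣≡n) (m+n∸n≡m m n))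

p⊆q∧∣q∣≤∣p∣⇒p≡q : {p q : Subset n} → p ⊆ q → ∣ q ∣ ≤ ∣ p ∣ → p ≡ q
p⊆q∧∣q∣≤∣p∣⇒p≡q {p = p} p⊆q ∣q∣≤∣p∣ = ⊆-antisym p⊆q q⊆p
  where
  q⊆p : _ ⊆ p
  q⊆p {x} x∈q = decidable-stable (x ∈? p)
    (λ x∉p → <⇒≱ (p⊂q⇒∣p∣<∣q∣ (p⊆q , x , x∈q , x∉p)) ∣q∣≤∣p∣)

meet⊎⊆∁ : (p q : Subset n) → (∃ λ x → x ∈ p × x ∈ q) ⊎ q ⊆ ∁ p
meet⊎⊆∁ p q with nonempty? (p ∩ q)
... | yes (x , x∈p∩q) = inj₁ (x , x∈p∩q⁻ p q x∈p∩q)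
... | no  disjoint    = inj₂ (λ x∈q → x∉p⇒x∈∁p (λ x∈p → disjoint (_ , x∈p∩q⁺ (x∈p , x∈q))))

module _ {r : ℕ} where

  isEdge : (e : Edge r) → IsEdgeP r (proj₁ e)
  isEdge e = toWitness (proj₂ e)

  Edge-≡ : {e f : Edge r} → proj₁ e ≡ proj₁ f → e ≡ f
  Edge-≡ {e = s , w} {f = .s , w′} refl = cong (s ,_) (T-irrelevant w w′)

  ++-isEdge : (p q : Subset r) → ∣ p ∣ + ∣ q ∣ ≡ r → Nonempty p → Nonempty q →
              IsEdgeP r (p ++ q)
  ++-isEdge p q size (i , i∈p) (j , j∈q) =
    trans (∣p++q∣≡∣p∣+∣q∣ p q) size ,
    (i , Equivalence.from (↑ˡ∈++⇔∈ p q) i∈p) ,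
    (j , Equivalence.from (↑ʳ∈++⇔∈ p q) j∈q)

  ∁-++-isEdge : (p q : Subset r) → IsEdgeP r (p ++ q) → IsEdgeP r (∁ (p ++ q))
  ∁-++-isEdge p q (∣p++q∣≡r , (i , i∈p++q) , (j , j∈p++q)) =
    subst (IsEdgeP r) (sym (∁-++ p q))
      (++-isEdge (∁ p) (∁ q) ∣∁p∣+∣∁q∣≡r (∣p∣<n⇒Nonempty∁p ∣p∣<r) (∣p∣<n⇒Nonempty∁p ∣q∣<r))
    where
    ∣p∣+∣q∣≡r : ∣ p ∣ + ∣ q ∣ ≡ r
    ∣p∣+∣q∣≡r = trans (sym (∣p++q∣≡∣p∣+∣q∣ p q)) ∣p++q∣≡r

    ∣∁p∣+∣∁q∣≡r : ∣ ∁ p ∣ + ∣ ∁ q ∣ ≡ r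
    ∣∁p∣+∣∁q∣≡r = begin
      ∣ ∁ p ∣ + ∣ ∁ q ∣  ≡⟨ ∣p++q∣≡∣p∣+∣q∣ (∁ p) (∁ q) ⟨
      ∣ ∁ p ++ ∁ q ∣     ≡⟨ cong ∣_∣ (∁-++ p q) ⟨
      ∣ ∁ (p ++ q) ∣     ≡⟨ ∣p∣≡n⇒∣∁p∣≡m (p ++ q) ∣p++q∣≡r ⟩
      r                  ∎
      where open ≡-Reasoning

    ∣p∣<r : ∣ p ∣ < r
    ∣p∣<r = subst (∣ p ∣ <_) ∣p∣+∣q∣≡r
      (m<m+n ∣ p ∣ (Nonempty⇒∣p∣>0 (j , Equivalence.to (↑ʳ∈++⇔∈ p q) j∈p++q)))

    ∣q∣<r : ∣ q ∣ < r
    ∣q∣<r = subst (∣ q ∣ <_) ∣p∣+∣q∣≡r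
      (m<n+m ∣ q ∣ (Nonempty⇒∣p∣>0 (i , Equivalence.to (↑ˡ∈++⇔∈ p q) i∈p++q)))

  ∁-isEdge : (s : Subset (r + r)) → IsEdgeP r s → IsEdgeP r (∁ s)
  ∁-isEdge s with splitAt r s
  ... | p , q , refl = ∁-++-isEdge p q

  ∁ᴱ : Edge r → Edge r
  ∁ᴱ e = ∁ (proj₁ e) , fromWitness (∁-isEdge (proj₁ e) (isEdge e))

  ∁ᴱ-involutive : (e : Edge r) → ∁ᴱ (∁ᴱ e) ≡ e
  ∁ᴱ-involutive e = Edge-≡ (∁-involutive (proj₁ e))

  Adjacent-irreflexive : Irreflexive _≡_ (Adjacent r)
  Adjacent-irreflexive refl (e≢e , _) = e≢e refl

  -- Disjoint hyperedges have r + r vertices between them, so they are complementary.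
  adjacent⊎complementary : (e f : Edge r) → proj₁ e ≢ proj₁ f →
                           Adjacent r e f ⊎ f ≡ ∁ᴱ e
  adjacent⊎complementary e f e≢f with meet⊎⊆∁ (proj₁ e) (proj₁ f)
  ... | inj₁ common = inj₁ (e≢f , common)
  ... | inj₂ f⊆∁e   = inj₂ (Edge-≡ (p⊆q∧∣q∣≤∣p∣⇒p≡q f⊆∁e (≤-reflexive ∣∁e∣≡∣f∣)))
    where
    ∣∁e∣≡∣f∣ : ∣ ∁ (proj₁ e) ∣ ≡ ∣ proj₁ f ∣
    ∣∁e∣≡∣f∣ = trans (∣p∣≡n⇒∣∁p∣≡m (proj₁ e) (proj₁ (isEdge e))) (sym (proj₁ (isEdge f)))

Star : (r : ℕ) → Vertex r → Set
Star r v = Σ (Edge r) (λ e → v ∈ proj₁ e)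

module _ {r : ℕ} (v : Vertex r) where

  Star-≡ : {x y : Star r v} → proj₁ (proj₁ x) ≡ proj₁ (proj₁ y) → x ≡ y
  Star-≡ {e , v∈e} {f , v∈f} eq with Edge-≡ {e = e} {f = f} eq
  ... | refl = cong (e ,_) ([]=-irrelevant v∈e v∈f)

  toStars : Edge r → Star r v ⊎ Star r v
  toStars e with v ∈? proj₁ e
  ... | yes v∈e = inj₁ (e , v∈e)
  ... | no  v∉e = inj₂ (∁ᴱ e , x∉p⇒x∈∁p v∉e)

  fromStars : Star r v ⊎ Star r v → Edge r
  fromStars = [ proj₁ , ∁ᴱ ∘ proj₁ ]′

  toStars-∈ : ∀ {e} (v∈e : v ∈ proj₁ e) → toStars e ≡ inj₁ (e , v∈e)
  toStars-∈ {e} v∈e with v ∈? proj₁ e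
  ... | yes _   = cong inj₁ (Star-≡ refl)
  ... | no  v∉e = contradiction v∈e v∉e

  toStars-∉ : ∀ {e} (v∉e : v ∉ proj₁ e) → toStars e ≡ inj₂ (∁ᴱ e , x∉p⇒x∈∁p v∉e)
  toStars-∉ {e} v∉e with v ∈? proj₁ e
  ... | yes v∈e = contradiction v∈e v∉e
  ... | no  _   = cong inj₂ (Star-≡ refl)

  toStars-∁ᴱ : ∀ e → toStars (∁ᴱ e) ≡ swap (toStars e)
  toStars-∁ᴱ e with v ∈? proj₁ e
  ... | yes v∈e = trans (toStars-∉ (x∈p⇒x∉∁p v∈e)) (cong inj₂ (Star-≡ (∁-involutive (proj₁ e))))
  ... | no  v∉e = toStars-∈ (x∉p⇒x∈∁p v∉e)

  toStars-fromStars : ∀ x → toStars (fromStars x) ≡ x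
  toStars-fromStars (inj₁ (e , v∈e)) = toStars-∈ v∈e
  toStars-fromStars (inj₂ (e , v∈e)) = trans (toStars-∁ᴱ e) (cong swap (toStars-∈ v∈e))

  fromStars-toStars : ∀ e → fromStars (toStars e) ≡ e
  fromStars-toStars e with v ∈? proj₁ e
  ... | yes _ = refl
  ... | no  _ = ∁ᴱ-involutive e

  edges↔stars : Edge r ↔ (Star r v ⊎ Star r v)
  edges↔stars = mk↔ₛ′ toStars fromStars toStars-fromStars fromStars-toStars

module _ {r δ : ℕ} {v : Vertex r} (deg : HasDegree r v δ) where
  open TotalDomination (Adjacent r) using (label)

  edges↔Fin⊎Fin : Edge r ↔ (Fin δ ⊎ Fin δ)
  edges↔Fin⊎Fin = ↔-trans (edges↔stars v) (↔-sym deg ⊎-↔ ↔-sym deg)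

  label-∁ᴱ : ∀ e → label edges↔Fin⊎Fin (∁ᴱ e) ≡ label edges↔Fin⊎Fin e
  label-∁ᴱ e = trans (cong (reduce ∘ map from from) (toStars-∁ᴱ v e)) (reduce-swap (toStars v e))
    where
    open Inverse deg using (from)
    reduce-swap : ∀ x → reduce (map from from (swap x)) ≡ reduce (map from from x)
    reduce-swap (inj₁ _) = refl
    reduce-swap (inj₂ _) = refl

  distinct-labels⇒Adjacent : ∀ {e f} → label edges↔Fin⊎Fin e ≢ label edges↔Fin⊎Fin f →
                             Adjacent r e f
  distinct-labels⇒Adjacent {e} {f} ℓe≢ℓf
    with adjacent⊎complementary e f (λ eq → ℓe≢ℓf (cong (label edges↔Fin⊎Fin) (Edge-≡ eq)))
  ... | inj₁ adjacent  = adjacent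
  ... | inj₂ refl = contradiction (sym (label-∁ᴱ e)) ℓe≢ℓf

2≤n-of-distinct : {i j : Fin n} → i ≢ j → 2 ≤ n
2≤n-of-distinct {1} {zero} {zero} i≢j = contradiction refl i≢j
2≤n-of-distinct {suc (suc n)} _ = s≤s (s≤s z≤n)

module _ {m : ℕ} where
  private
    r : ℕ
    r = 2 + m

    x₀ : Fin r
    x₀ = zero

  x₀-edge : (j k : Fin r) → k ≢ j → Edge r
  x₀-edge j k k≢j = ⁅ x₀ ⁆ ++ ∁ ⁅ j ⁆ , fromWitness
    (++-isEdge ⁅ x₀ ⁆ (∁ ⁅ j ⁆) size (x₀ , here) (k , x∉p⇒x∈∁p (x≢y⇒x∉⁅y⁆ k≢j)))
    where
    size : ∣ ⁅ x₀ ⁆ ∣ + ∣ ∁ ⁅ j ⁆ ∣ ≡ r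
    size = cong₂ _+_ (∣⁅x⁆∣≡1 x₀) (trans (∣∁p∣≡n∸∣p∣ ⁅ j ⁆) (cong (r ∸_) (∣⁅x⁆∣≡1 j)))

  2≤degree : ∀ {δ} → HasDegree r (x₀ ↑ˡ r) δ → 2 ≤ δ
  2≤degree deg = 2≤n-of-distinct indices-distinct
    where
    open Inverse deg using (from)

    e₀ e₁ : Edge r
    e₀ = x₀-edge zero (suc zero) (λ ())
    e₁ = x₀-edge (suc zero) zero (λ ())

    e₀≢e₁ : proj₁ e₀ ≢ proj₁ e₁
    e₀≢e₁ eq with ∷-injectiveˡ (++-injectiveʳ ⁅ x₀ ⁆ ⁅ x₀ ⁆ eq)
    ... | ()

    from-injective : Injective _≡_ _≡_ from
    from-injective = Injection.injective (↔⇒↣ (↔-sym deg))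

    indices-distinct : from (e₀ , here) ≢ from (e₁ , here)
    indices-distinct eq = e₀≢e₁ (cong (proj₁ ∘ proj₁) (from-injective eq))

lemma12 : (r : ℕ) → 2 ≤ r → (δ : ℕ) → (∀ (v : Vertex r) → HasDegree r v δ)
    → TotalEdgeDomaticNumberIs r δ
lemma12 .(2 + m) (s≤s (s≤s {n = m} z≤n)) δ deg =
  totalDomaticNumber-pairs (edges↔Fin⊎Fin (deg zero))
    Adjacent-irreflexive (distinct-labels⇒Adjacent (deg zero)) (2≤degree (deg zero))
  where open TotalDomination (Adjacent (2 + m))
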